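{- Let $m\ge 2$ and let $h$ be a natural number with $h>3$. If $h\le m+1$, then every residue class modulo $h$ appears infinitely many times in the sequence $(b_m(n)\bmod h)_{n\in\mathbb N_0}$, and every residue class modulo $h$ appears infinitely many times in the sequence $(c_m(n)\bmod h)_{n\in\mathbb N_0}$. If $h\le m$ and $h$ is odd, then every residue class modulo $h$ appears infinitely many times in the sequence $(\overline{b}_m(n)\bmod h)_{n\in\mathbb N_0}$.
   Context: $\mathbb N=\{1,2,\dots\}$, $\mathbb N_0=\mathbb N\cup\{0\}$. For $m\ge2$ and $n\in\mathbb N_0$, $b_m(n)$ is the number of $m$-ary partitions of $n$, i.e. the number of representations $n=n_0+n_1m+n_2m^2+\dots+n_tm^t$ with all $n_i\in\mathbb N_0$ (representations differing only by trailing zero coefficients are identified). $c_m(n)$ is the number of such representations with no gaps, i.e. those in which for every $j\ge1$, $n_j>0$ implies $n_{j-1}>0$ (so $c_m(0)=c_m(1)=1$). The sequence $(\overline{b}_m(n))_{n\in\mathbb N_0}$ is defined by $\overline{b}_m(0)=1$, $\overline{b}_m(mn)=\overline{b}_m(mn+1)=\dots=\overline{b}_m(mn+m-1)$ for $n\ge0$, and $\overline{b}_m(mn)-\overline{b}_m(mn-1)=\overline{b}_m(n)+\overline{b}_m(n-1)$ for $n\ge1$. -}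

module Defs where

open import Data.Nat using (ℕ; zero; suc; _+_; _*_; _^_; _∸_; _<_; _≤_; _≡ᵇ_; _<ᵇ_; NonZero)
open import Data.Bool using (Bool; true; false; _∧_; _∨_; not)
open import Data.List using (List; []; _∷_; map; concatMap; upTo; filterᵇ; length)
open import Data.Product using (∃-syntax; _×_)
open import Relation.Binary.PropositionalEquality using (_≡_)

value : ℕ → List ℕ → ℕ
value m []       = 0
value m (x ∷ xs) = x + m * value m xs

-- canonical representative of a representation: no trailing zero coefficient
-- (the empty list represents 0)
noTrailingZero : List ℕ → Bool
noTrailingZero []           = true
noTrailingZero (x ∷ [])     = not (x ≡ᵇ 0)
noTrailingZero (x ∷ y ∷ xs) = noTrailingZero (y ∷ xs)

noGaps : List ℕ → Bool
noGaps []           = true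
noGaps (x ∷ [])     = true
noGaps (x ∷ y ∷ xs) = (not (0 <ᵇ y) ∨ (0 <ᵇ x)) ∧ noGaps (y ∷ xs)

lists : ℕ → ℕ → List (List ℕ)
lists zero    B = [] ∷ []
lists (suc L) B = concatMap (λ x → map (x ∷_) (lists L B)) (upTo (suc B))

-- all lists of length ≤ n+1 with entries ≤ n; every canonical representation
-- of n (entries ≤ n, highest index t with mᵗ ≤ n, so t ≤ n) is among them,
-- each exactly once
candidates : ℕ → List (List ℕ)
candidates n = concatMap (λ L → lists L n) (upTo (suc (suc n)))

isRep : ℕ → ℕ → List ℕ → Bool
isRep m n xs = (value m xs ≡ᵇ n) ∧ noTrailingZero xs

b : ℕ → ℕ → ℕ
b m n = length (filterᵇ (isRep m n) (candidates n))

c : ℕ → ℕ → ℕ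
c m n = length (filterᵇ (λ xs → isRep m n xs ∧ noGaps xs) (candidates n))

-- f is the sequence b̄_m, given by its defining recurrences
-- (for m ≥ 2 these determine f uniquely)
IsBbar : ℕ → (ℕ → ℕ) → Set
IsBbar m f =
  (f 0 ≡ 1)
  × (∀ n r → r < m → f (m * n + r) ≡ f (m * n))
  × (∀ n → 1 ≤ n → f (m * n) ≡ f (m * n ∸ 1) + (f n + f (n ∸ 1)))

-- every residue class modulo h appears infinitely often in (f n mod h)
-- (f n mod h ≡ r, for 0 ≤ r < h, written as f n ≡ q * h + r)
EveryResidueInfinitelyOften : ℕ → (ℕ → ℕ) → Set
EveryResidueInfinitelyOften h f =
  ∀ r → r < h → ∀ N → ∃[ n ] (N ≤ n × ∃[ q ] (f n ≡ q * h + r))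

module Submission where

-- Reading off the lowest digit x of a representation of n (so x ≡ n mod m and the
-- remaining digits represent (n - x)/m) gives b(n+1) = b(n) + [m ∣ n+1] b((n+1)/m),
-- and, since the gapless representations are exactly those with all digits positive,
-- c(n+2) = c(n+1) + [m ∣ n+1] c((n+1)/m). Consequently the sequences G(N) = b(mN),
-- c(mN+1), b̄(mN) satisfy G(N+1) = G(N) + s G(M), with s = 1, 1, 2, on a run of m+1,
-- m+1, m consecutive values of N starting at about mM. If G(M) and s are invertible
-- modulo h and the run has at least h terms, it meets every residue class; in particular
-- it contains an index M' > M with G(M') ≡ 1, so the argument restarts at M'. It starts
-- from G(h-2) = h-1 for b and c, and from G(h-1) = 2h-1 for b̄, both ≡ -1 mod h.

open import Defs
open import Algebra.Bundles using (CommutativeMonoid)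
open import Data.Bool using (Bool; true; false; _∧_; not; if_then_else_; T)
open import Data.Bool.Properties using (∧-assoc; ∧-comm; ∧-zeroʳ; ∧-commutativeMonoid; if-eta; T-∧)
open import Data.Empty using (⊥-elim)
open import Data.List using (List; []; _∷_; map; concatMap; applyUpTo; filterᵇ; length; _++_)
open import Data.Bool.ListAction using (all)
open import Data.List.Properties using (filter-++; length-++)
open import Data.Nat
  using (ℕ; zero; suc; _+_; _*_; _∸_; pred; _≤_; _<_; _<ᵇ_; _≡ᵇ_; z≤n; s≤s; z<s; s<s; NonZero; >-nonZero⁻¹)
open import Data.Nat.Properties
open import Data.Nat.DivMod
open import Data.Nat.Divisibility using (_∣_; m%n≡0⇒n∣m)
open import Data.Nat.Tactic.RingSolver using (solve-∀)
open import Data.Product using (_×_; ∃-syntax; _,_; proj₁; proj₂)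
open import Function using (_∘_; Equivalence; it)
open import Relation.Binary.PropositionalEquality
open import Relation.Nullary using (¬_)
open import Relation.Nullary.Decidable using (T?)

open import Algebra.Properties.CommutativeSemigroup +-commutativeSemigroup
  using () renaming (interchange to +-interchange)
open import Algebra.Properties.CommutativeSemigroup
  (CommutativeMonoid.commutativeSemigroup ∧-commutativeMonoid)
  using () renaming (interchange to ∧-interchange)

∑< : ℕ → (ℕ → ℕ) → ℕ
∑< zero    f = 0
∑< (suc n) f = f 0 + ∑< n (f ∘ suc)

syntax ∑< n (λ i → e) = ∑[ i < n ] e

∑-cong : ∀ n {f g : ℕ → ℕ} → (∀ i → i < n → f i ≡ g i) → ∑< n f ≡ ∑< n g
∑-cong zero    f≗g = refl
∑-cong (suc n) f≗g = cong₂ _+_ (f≗g 0 z<s) (∑-cong n (λ i i<n → f≗g (suc i) (s<s i<n)))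

∑-zero : ∀ n → ∑[ i < n ] 0 ≡ 0
∑-zero zero    = refl
∑-zero (suc n) = ∑-zero n

∑-distrib-+ : ∀ n (f g : ℕ → ℕ) → ∑[ i < n ] (f i + g i) ≡ ∑< n f + ∑< n g
∑-distrib-+ zero    f g = refl
∑-distrib-+ (suc n) f g = trans (cong (f 0 + g 0 +_) (∑-distrib-+ n (f ∘ suc) (g ∘ suc)))
                                (+-interchange (f 0) (g 0) _ _)

∑-comm : ∀ a b (f : ℕ → ℕ → ℕ) → ∑[ i < a ] ∑< b (f i) ≡ ∑[ j < b ] ∑[ i < a ] f i j
∑-comm zero    b f = sym (∑-zero b)
∑-comm (suc a) b f = trans (cong (∑< b (f 0) +_) (∑-comm a b (f ∘ suc)))
                           (sym (∑-distrib-+ b (f 0) _))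

∑-if : ∀ c n (f : ℕ → ℕ) → ∑[ i < n ] (if c then f i else 0) ≡ (if c then ∑< n f else 0)
∑-if true  n f = refl
∑-if false n f = ∑-zero n

∑-split : ∀ k l (f : ℕ → ℕ) → ∑< (k + l) f ≡ ∑< k f + ∑[ i < l ] f (k + i)
∑-split zero    l f = refl
∑-split (suc k) l f = trans (cong (f 0 +_) (∑-split k l (f ∘ suc))) (sym (+-assoc (f 0) _ _))

∑-truncate : ∀ {k n} (f : ℕ → ℕ) → k ≤ n → (∀ i → k ≤ i → i < n → f i ≡ 0) → ∑< n f ≡ ∑< k f
∑-truncate {k} f k≤n vanish with m≤n⇒∃[o]m+o≡n k≤n
... | l , refl = begin
  ∑< (k + l) f                   ≡⟨ ∑-split k l f ⟩
  ∑< k f + ∑[ i < l ] f (k + i)  ≡⟨ cong (∑< k f +_) tail≡0 ⟩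
  ∑< k f + 0                     ≡⟨ +-identityʳ _ ⟩
  ∑< k f                         ∎
  where
  open ≡-Reasoning
  tail≡0 : ∑[ i < l ] f (k + i) ≡ 0
  tail≡0 = trans (∑-cong l (λ i i<l → vanish (k + i) (m≤m+n k i) (+-monoʳ-< k i<l))) (∑-zero l)

count : {A : Set} → (A → Bool) → List A → ℕ
count p xs = length (filterᵇ p xs)

count-++ : ∀ {A : Set} (p : A → Bool) xs ys → count p (xs ++ ys) ≡ count p xs + count p ys
count-++ p xs ys = trans (cong length (filter-++ (T? ∘ p) xs ys)) (length-++ (filterᵇ p xs))

count-map : ∀ {A B : Set} (p : B → Bool) (g : A → B) xs → count p (map g xs) ≡ count (p ∘ g) xs
count-map p g []       = refl
count-map p g (x ∷ xs) with p (g x)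
... | true  = cong suc (count-map p g xs)
... | false = count-map p g xs

count-cong : ∀ {A : Set} {p q : A → Bool} → (∀ x → p x ≡ q x) → ∀ xs → count p xs ≡ count q xs
count-cong p≗q []       = refl
count-cong {q = q} p≗q (x ∷ xs) rewrite p≗q x with q x
... | true  = cong suc (count-cong p≗q xs)
... | false = count-cong p≗q xs

count-none : ∀ {A : Set} (xs : List A) → count (λ _ → false) xs ≡ 0
count-none []       = refl
count-none (x ∷ xs) = count-none xs

count-∧ : ∀ {A : Set} c (q : A → Bool) xs → count (λ x → c ∧ q x) xs ≡ (if c then count q xs else 0)
count-∧ true  q xs = refl
count-∧ false q xs = count-none xs

count-concatMap : ∀ {A B : Set} (p : B → Bool) (f : A → List B) (g : ℕ → A) n →
                  count p (concatMap f (applyUpTo g n)) ≡ ∑[ i < n ] count p (f (g i))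
count-concatMap p f g zero    = refl
count-concatMap p f g (suc n) = trans (count-++ p (f (g 0)) _)
                                      (cong (count p (f (g 0)) +_) (count-concatMap p f (g ∘ suc) n))

count-lists-suc : ∀ (p : List ℕ → Bool) L B →
                  count p (lists (suc L) B) ≡ ∑[ x < suc B ] count (λ xs → p (x ∷ xs)) (lists L B)
count-lists-suc p L B = trans (count-concatMap p (λ x → map (x ∷_) (lists L B)) (λ x → x) (suc B))
                              (∑-cong (suc B) (λ x _ → count-map p (x ∷_) (lists L B)))

fits : (m : ℕ) .{{_ : NonZero m}} → ℕ → ℕ → Bool
fits m n x = (x <ᵇ suc n) ∧ ((n ∸ x) % m ≡ᵇ 0)

splitTerm : (m : ℕ) .{{_ : NonZero m}} → (ℕ → Bool) → (ℕ → ℕ) → ℕ → ℕ → ℕ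
splitTerm m ok g n x = if ok x ∧ fits m n x then g ((n ∸ x) / m) else 0

splitSum : (m : ℕ) .{{_ : NonZero m}} → (ℕ → Bool) → (ℕ → ℕ) → ℕ → ℕ
splitSum m ok g n = ∑[ x < suc n ] splitTerm m ok g n x

spread : (m : ℕ) .{{_ : NonZero m}} → (ℕ → ℕ) → ℕ → ℕ
spread m g j = if j % m ≡ᵇ 0 then g (j / m) else 0

anyDigit positiveDigit : ℕ → Bool
anyDigit _    = true
positiveDigit = 0 <ᵇ_

<ᵇ-false : ∀ {x n} → n ≤ x → (x <ᵇ n) ≡ false
<ᵇ-false z≤n       = refl
<ᵇ-false (s≤s n≤x) = <ᵇ-false n≤x

module _ (m : ℕ) .{{_ : NonZero m}} where

  splitSum-cong : 1 < m → ∀ ok n {g g'} → (∀ q → q < suc n → g q ≡ g' q) →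
                  splitSum m ok g (suc n) ≡ splitSum m ok g' (suc n)
  splitSum-cong 1<m ok n g≗g' = ∑-cong (suc (suc n)) λ x _ →
    cong (λ v → if ok x ∧ fits m (suc n) x then v else 0) (g≗g' _ (quotient<n x))
    where
    quotient<n : ∀ x → (suc n ∸ x) / m < suc n
    quotient<n x = ≤-<-trans (/-monoˡ-≤ m (m∸n≤m (suc n) x)) (m/n<m (suc n) m 1<m)

  splitSum-zero : ∀ ok n → splitSum m ok (λ _ → 0) n ≡ 0
  splitSum-zero ok n = trans (∑-cong (suc n) {g = λ _ → 0} (λ x _ → if-eta (ok x ∧ fits m n x))) (∑-zero (suc n))

  splitSum-∑ : ∀ ok (g : ℕ → ℕ → ℕ) k n →
               ∑[ L < k ] splitSum m ok (g L) n ≡ splitSum m ok (λ q → ∑[ L < k ] g L q) n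
  splitSum-∑ ok g k n = trans (∑-comm k (suc n) (λ L → splitTerm m ok (g L) n))
                              (∑-cong (suc n) (λ x _ → ∑-if (ok x ∧ fits m n x) k (λ L → g L ((n ∸ x) / m))))

  splitSum-any-zero : ∀ g → splitSum m anyDigit g 0 ≡ g 0
  splitSum-any-zero g rewrite m<n⇒m%n≡m (>-nonZero⁻¹ m) | 0/n≡0 m {{it}} = +-identityʳ (g 0)

  splitSum-any-suc : ∀ g n → splitSum m anyDigit g (suc n) ≡ spread m g (suc n) + splitSum m anyDigit g n
  splitSum-any-suc g n = refl

  splitSum-positive-suc : ∀ g n → splitSum m positiveDigit g (suc n) ≡ splitSum m anyDigit g n
  splitSum-positive-suc g n = refl

  fits-beyond : ∀ {n x} → n < x → fits m n x ≡ false
  fits-beyond {n} {x} n<x = cong (_∧ ((n ∸ x) % m ≡ᵇ 0)) (<ᵇ-false n<x)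

-- p n xs says that xs is a representation of n with all digits satisfying ok; the
-- hypotheses describe p through the lowest digit.
module RepresentationCount (m : ℕ) .{{_ : NonZero m}} (1<m : 1 < m)
  (ok : ℕ → Bool) (p : ℕ → List ℕ → Bool)
  (p-[]     : ∀ n → p n [] ≡ (n ≡ᵇ 0))
  (p-zero-∷ : ∀ x xs → p 0 (x ∷ xs) ≡ false)
  (p-suc-∷  : ∀ n x xs → p (suc n) (x ∷ xs) ≡ (ok x ∧ fits m (suc n) x) ∧ p ((suc n ∸ x) / m) xs)
  where

  exact : ℕ → ℕ → ℕ
  exact zero    zero    = 1
  exact zero    (suc n) = 0
  exact (suc L) zero    = 0
  exact (suc L) (suc n) = splitSum m ok (exact L) (suc n)

  count-lists : ∀ L B n → n ≤ B → count (p n) (lists L B) ≡ exact L n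
  count-lists zero    B zero    _ rewrite p-[] 0       = refl
  count-lists zero    B (suc n) _ rewrite p-[] (suc n) = refl
  count-lists (suc L) B zero    _ = begin
    count (p 0) (lists (suc L) B)                           ≡⟨ count-lists-suc (p 0) L B ⟩
    ∑[ x < suc B ] count (λ xs → p 0 (x ∷ xs)) (lists L B)  ≡⟨ ∑-cong (suc B) (λ x _ → none x) ⟩
    ∑[ x < suc B ] 0                                        ≡⟨ ∑-zero (suc B) ⟩
    0                                                       ∎
    where
    open ≡-Reasoning
    none : ∀ x → count (λ xs → p 0 (x ∷ xs)) (lists L B) ≡ 0
    none x = trans (count-cong (p-zero-∷ x) (lists L B)) (count-none (lists L B))
  count-lists (suc L) B (suc n) n≤B = begin
    count (p (suc n)) (lists (suc L) B)                           ≡⟨ count-lists-suc (p (suc n)) L B ⟩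
    ∑[ x < suc B ] count (λ xs → p (suc n) (x ∷ xs)) (lists L B)  ≡⟨ ∑-cong (suc B) (λ x _ → first-digit x) ⟩
    ∑[ x < suc B ] term x                                         ≡⟨ ∑-truncate term (s≤s n≤B) (λ x n<x _ → beyond x n<x) ⟩
    splitSum m ok (exact L) (suc n)                               ∎
    where
    open ≡-Reasoning
    term : ℕ → ℕ
    term = splitTerm m ok (exact L) (suc n)
    first-digit : ∀ x → count (λ xs → p (suc n) (x ∷ xs)) (lists L B) ≡ term x
    first-digit x = begin
      count (λ xs → p (suc n) (x ∷ xs)) (lists L B)      ≡⟨ count-cong (p-suc-∷ n x) (lists L B) ⟩
      count (λ xs → admits ∧ p q xs) (lists L B)        ≡⟨ count-∧ admits (p q) (lists L B) ⟩
      (if admits then count (p q) (lists L B) else 0)    ≡⟨ cong (λ v → if admits then v else 0) (count-lists L B q q≤B) ⟩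
      term x                                             ∎
      where
      admits = ok x ∧ fits m (suc n) x
      q = (suc n ∸ x) / m
      q≤B : q ≤ B
      q≤B = ≤-trans (m/n≤m (suc n ∸ x) m) (≤-trans (m∸n≤m (suc n) x) n≤B)
    beyond : ∀ x → suc n < x → term x ≡ 0
    beyond x n<x rewrite fits-beyond m n<x | ∧-zeroʳ (ok x) = refl

  exact-vanishes : ∀ L n → suc n < L → exact L n ≡ 0
  exact-vanishes (suc L) zero    _          = refl
  exact-vanishes (suc L) (suc n) (s≤s 2+n≤L) =
    trans (splitSum-cong m 1<m ok n (λ q q<1+n → exact-vanishes L q (≤-<-trans q<1+n 2+n≤L)))
          (splitSum-zero m ok (suc n))

  counts : ℕ → ℕ
  counts n = count (p n) (candidates n)

  counts-by-length : ∀ n → counts n ≡ ∑[ L < suc (suc n) ] exact L n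
  counts-by-length n = trans (count-concatMap (p n) (λ L → lists L n) (λ L → L) (suc (suc n)))
                             (∑-cong (suc (suc n)) (λ L _ → count-lists L n n ≤-refl))

  counts-zero : counts 0 ≡ 1
  counts-zero = counts-by-length 0

  counts-suc : ∀ n → counts (suc n) ≡ splitSum m ok counts (suc n)
  counts-suc n = begin
    counts (suc n)                                          ≡⟨ counts-by-length (suc n) ⟩
    ∑[ L < suc (suc n) ] splitSum m ok (exact L) (suc n)    ≡⟨ splitSum-∑ m ok exact (suc (suc n)) (suc n) ⟩
    splitSum m ok (λ q → ∑[ L < suc (suc n) ] exact L q) (suc n)
      ≡⟨ splitSum-cong m 1<m ok n (λ q q<1+n → stable q (≤-pred q<1+n)) ⟩
    splitSum m ok counts (suc n)                            ∎
    where
    open ≡-Reasoning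
    stable : ∀ q → q ≤ n → ∑[ L < suc (suc n) ] exact L q ≡ counts q
    stable q q≤n = trans (∑-truncate (λ L → exact L q) (s≤s (s≤s q≤n)) (λ L 2+q≤L _ → exact-vanishes L q 2+q≤L))
                         (sym (counts-by-length q))

T-injective : ∀ {a b} → (T a → T b) → (T b → T a) → a ≡ b
T-injective {false} {false} _   _   = refl
T-injective {false} {true}  _   b⇒a = ⊥-elim (b⇒a _)
T-injective {true}  {false} a⇒b _   = ⊥-elim (a⇒b _)
T-injective {true}  {true}  _   _   = refl

T-∧-intro : ∀ {a b} → T a → T b → T (a ∧ b)
T-∧-intro ta tb = Equivalence.from T-∧ (ta , tb)

module _ (m : ℕ) .{{_ : NonZero m}} where

  [m*v]%m≡0 : ∀ v → (m * v) % m ≡ 0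
  [m*v]%m≡0 v = trans (cong (_% m) (*-comm m v)) (m*n%n≡0 v m)

  [m*v]/m≡v : ∀ v → (m * v) / m ≡ v
  [m*v]/m≡v v = trans (cong (_/ m) (*-comm m v)) (m*n/n≡m v m)

  value-∷ : ∀ x v n → (x + m * v ≡ᵇ n) ≡ fits m n x ∧ (v ≡ᵇ (n ∸ x) / m)
  value-∷ x v n = T-injective split join
    where
    split : T (x + m * v ≡ᵇ n) → T (fits m n x ∧ (v ≡ᵇ (n ∸ x) / m))
    split t = T-∧-intro (T-∧-intro (<⇒<ᵇ (s≤s x≤n)) (≡⇒≡ᵇ _ 0 (trans (cong (_% m) rest) ([m*v]%m≡0 v))))
                        (≡⇒≡ᵇ v _ (sym (trans (cong (_/ m) rest) ([m*v]/m≡v v))))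
      where
      x+mv≡n = ≡ᵇ⇒≡ _ n t
      x≤n : x ≤ n
      x≤n = subst (x ≤_) x+mv≡n (m≤m+n x (m * v))
      rest : n ∸ x ≡ m * v
      rest = trans (cong (_∸ x) (sym x+mv≡n)) (m+n∸m≡n x (m * v))
    join : T (fits m n x ∧ (v ≡ᵇ (n ∸ x) / m)) → T (x + m * v ≡ᵇ n)
    join t with Equivalence.to T-∧ t
    ... | t-fits , t-v with Equivalence.to T-∧ t-fits
    ... | t-x , t-mod = ≡⇒≡ᵇ _ n (begin
      x + m * v                ≡⟨ cong (λ u → x + m * u) (≡ᵇ⇒≡ v _ t-v) ⟩
      x + m * ((n ∸ x) / m)    ≡⟨ cong (x +_) (m*[n/m]≡n (m%n≡0⇒n∣m (n ∸ x) m (≡ᵇ⇒≡ _ 0 t-mod))) ⟩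
      x + (n ∸ x)              ≡⟨ m+[n∸m]≡n (≤-pred (<ᵇ⇒< x (suc n) t-x)) ⟩
      n                        ∎)
      where open ≡-Reasoning

  isRep-[] : ∀ n → isRep m n [] ≡ (n ≡ᵇ 0)
  isRep-[] zero    = refl
  isRep-[] (suc n) = refl

  m*v≡ᵇ0 : ∀ v → (m * v ≡ᵇ 0) ≡ (v ≡ᵇ 0)
  m*v≡ᵇ0 v = T-injective (λ t → ≡⇒≡ᵇ v 0 (m*n≡0⇒m≡0 v m (trans (*-comm v m) (≡ᵇ⇒≡ _ 0 t))))
                         (λ t → ≡⇒≡ᵇ _ 0 (trans (cong (m *_) (≡ᵇ⇒≡ v 0 t)) (*-zeroʳ m)))

  isRep-zero-∷ : ∀ x xs → isRep m 0 (x ∷ xs) ≡ false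
  isRep-zero-∷ (suc x) xs       = refl
  isRep-zero-∷ zero    []       = ∧-zeroʳ _
  isRep-zero-∷ zero    (y ∷ ys) = trans (cong (_∧ noTrailingZero (y ∷ ys)) (m*v≡ᵇ0 (value m (y ∷ ys))))
                                        (isRep-zero-∷ y ys)

  isRep-suc-∷ : ∀ n x xs → isRep m (suc n) (x ∷ xs) ≡ fits m (suc n) x ∧ isRep m ((suc n ∸ x) / m) xs
  isRep-suc-∷ n x []       = begin
    (x + m * 0 ≡ᵇ suc n) ∧ not (x ≡ᵇ 0)                ≡⟨ digit-nonzero x ⟩
    (x + m * 0 ≡ᵇ suc n) ∧ true                        ≡⟨ cong (_∧ true) (value-∷ x 0 (suc n)) ⟩
    (fits m (suc n) x ∧ (0 ≡ᵇ (suc n ∸ x) / m)) ∧ true  ≡⟨ ∧-assoc (fits m (suc n) x) _ true ⟩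
    fits m (suc n) x ∧ ((0 ≡ᵇ (suc n ∸ x) / m) ∧ true)  ∎
    where
    open ≡-Reasoning
    digit-nonzero : ∀ x → (x + m * 0 ≡ᵇ suc n) ∧ not (x ≡ᵇ 0) ≡ (x + m * 0 ≡ᵇ suc n) ∧ true
    digit-nonzero zero    rewrite *-zeroʳ m = refl
    digit-nonzero (suc x) = refl
  isRep-suc-∷ n x (y ∷ ys) =
    trans (cong (_∧ noTrailingZero (y ∷ ys)) (value-∷ x (value m (y ∷ ys)) (suc n)))
          (∧-assoc (fits m (suc n) x) _ _)

noTrailingZero∧noGaps : ∀ xs → noTrailingZero xs ∧ noGaps xs ≡ all positiveDigit xs
noTrailingZero∧noGaps []                   = refl
noTrailingZero∧noGaps (zero  ∷ [])         = refl
noTrailingZero∧noGaps (suc x ∷ [])         = refl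
noTrailingZero∧noGaps (zero  ∷ zero ∷ ys)  = noTrailingZero∧noGaps (zero ∷ ys)
noTrailingZero∧noGaps (suc x ∷ zero ∷ ys)  = noTrailingZero∧noGaps (zero ∷ ys)
noTrailingZero∧noGaps (zero  ∷ suc y ∷ ys) = ∧-zeroʳ (noTrailingZero (suc y ∷ ys))
noTrailingZero∧noGaps (suc x ∷ suc y ∷ ys) = noTrailingZero∧noGaps (suc y ∷ ys)

module _ (m : ℕ) .{{_ : NonZero m}} where

  gapless : ℕ → List ℕ → Bool
  gapless n xs = isRep m n xs ∧ noGaps xs

  gapless-positive : ∀ n xs → gapless n xs ≡ (value m xs ≡ᵇ n) ∧ all positiveDigit xs
  gapless-positive n xs = trans (∧-assoc (value m xs ≡ᵇ n) _ _)
                                (cong ((value m xs ≡ᵇ n) ∧_) (noTrailingZero∧noGaps xs))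

  gapless-[] : ∀ n → gapless n [] ≡ (n ≡ᵇ 0)
  gapless-[] zero    = refl
  gapless-[] (suc n) = refl

  gapless-zero-∷ : ∀ x xs → gapless 0 (x ∷ xs) ≡ false
  gapless-zero-∷ x xs = cong (_∧ noGaps (x ∷ xs)) (isRep-zero-∷ m x xs)

  gapless-suc-∷ : ∀ n x xs →
    gapless (suc n) (x ∷ xs) ≡ (positiveDigit x ∧ fits m (suc n) x) ∧ gapless ((suc n ∸ x) / m) xs
  gapless-suc-∷ n x xs = begin
    gapless (suc n) (x ∷ xs)                                  ≡⟨ gapless-positive (suc n) (x ∷ xs) ⟩
    (x + m * v ≡ᵇ suc n) ∧ (positiveDigit x ∧ all positiveDigit xs)
      ≡⟨ cong (_∧ _) (value-∷ m x v (suc n)) ⟩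
    (fits m (suc n) x ∧ (v ≡ᵇ q)) ∧ (positiveDigit x ∧ all positiveDigit xs)
      ≡⟨ ∧-interchange (fits m (suc n) x) _ _ _ ⟩
    (fits m (suc n) x ∧ positiveDigit x) ∧ ((v ≡ᵇ q) ∧ all positiveDigit xs)
      ≡⟨ cong₂ _∧_ (∧-comm (fits m (suc n) x) _) (sym (gapless-positive q xs)) ⟩
    (positiveDigit x ∧ fits m (suc n) x) ∧ gapless q xs       ∎
    where
    open ≡-Reasoning
    v = value m xs
    q = (suc n ∸ x) / m

module _ (m : ℕ) .{{_ : NonZero m}} (1<m : 1 < m) where

  private
    module B = RepresentationCount m 1<m anyDigit (isRep m) (isRep-[] m) (isRep-zero-∷ m) (isRep-suc-∷ m)
    module C = RepresentationCount m 1<m positiveDigit (gapless m) (gapless-[] m) (gapless-zero-∷ m) (gapless-suc-∷ m)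

  b-zero : b m 0 ≡ 1
  b-zero = B.counts-zero

  b-splitSum : ∀ n → b m n ≡ splitSum m anyDigit (b m) n
  b-splitSum zero    = sym (splitSum-any-zero m (b m))
  b-splitSum (suc n) = B.counts-suc n

  b-suc : ∀ n → b m (suc n) ≡ b m n + spread m (b m) (suc n)
  b-suc n = begin
    b m (suc n)                                             ≡⟨ b-splitSum (suc n) ⟩
    splitSum m anyDigit (b m) (suc n)                       ≡⟨ splitSum-any-suc m (b m) n ⟩
    spread m (b m) (suc n) + splitSum m anyDigit (b m) n    ≡⟨ cong (spread m (b m) (suc n) +_) (sym (b-splitSum n)) ⟩
    spread m (b m) (suc n) + b m n                          ≡⟨ +-comm _ (b m n) ⟩
    b m n + spread m (b m) (suc n)                          ∎
    where open ≡-Reasoning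

  c-zero : c m 0 ≡ 1
  c-zero = C.counts-zero

  c-splitSum : ∀ n → c m (suc n) ≡ splitSum m anyDigit (c m) n
  c-splitSum n = trans (C.counts-suc n) (splitSum-positive-suc m (c m) n)

  c-one : c m 1 ≡ 1
  c-one = trans (c-splitSum 0) (trans (splitSum-any-zero m (c m)) c-zero)

  c-suc : ∀ n → c m (suc (suc n)) ≡ c m (suc n) + spread m (c m) (suc n)
  c-suc n = begin
    c m (suc (suc n))                                       ≡⟨ c-splitSum (suc n) ⟩
    splitSum m anyDigit (c m) (suc n)                       ≡⟨ splitSum-any-suc m (c m) n ⟩
    spread m (c m) (suc n) + splitSum m anyDigit (c m) n    ≡⟨ cong (spread m (c m) (suc n) +_) (sym (c-splitSum n)) ⟩
    spread m (c m) (suc n) + c m (suc n)                    ≡⟨ +-comm _ (c m (suc n)) ⟩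
    c m (suc n) + spread m (c m) (suc n)                    ∎
    where open ≡-Reasoning

module _ (m : ℕ) .{{_ : NonZero m}} where

  [m*q+r]%m≡r : ∀ q {r} → r < m → (m * q + r) % m ≡ r
  [m*q+r]%m≡r q {r} r<m = begin
    (m * q + r) % m   ≡⟨ cong (_% m) (trans (+-comm (m * q) r) (cong (r +_) (*-comm m q))) ⟩
    (r + q * m) % m   ≡⟨ [m+kn]%n≡m%n r q m ⟩
    r % m             ≡⟨ m<n⇒m%n≡m r<m ⟩
    r                 ∎
    where open ≡-Reasoning

  m*[1+q]≡1+[m*q+pred[m]] : ∀ q → m * suc q ≡ suc (m * q + pred m)
  m*[1+q]≡1+[m*q+pred[m]] q = begin
    m * suc q            ≡⟨ *-suc m q ⟩
    m + m * q            ≡⟨ +-comm m (m * q) ⟩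
    m * q + m            ≡⟨ cong (m * q +_) (sym (suc-pred m)) ⟩
    m * q + suc (pred m) ≡⟨ +-suc (m * q) (pred m) ⟩
    suc (m * q + pred m) ∎
    where open ≡-Reasoning

  spread-multiple : ∀ g q → spread m g (m * q) ≡ g q
  spread-multiple g q rewrite [m*v]%m≡0 m q | [m*v]/m≡v m q = refl

  spread-between : ∀ g q {r} → suc r < m → spread m g (suc (m * q + r)) ≡ 0
  spread-between g q {r} 1+r<m rewrite sym (+-suc (m * q) r) | [m*q+r]%m≡r q 1+r<m = refl

  module Staircase (F g : ℕ → ℕ) (F-suc : ∀ n → F (suc n) ≡ F n + spread m g (suc n)) where

    flat : ∀ q {r} → r < m → F (m * q + r) ≡ F (m * q)
    flat q {zero}  _     = cong F (+-identityʳ (m * q))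
    flat q {suc r} 1+r<m = begin
      F (m * q + suc r)                              ≡⟨ cong F (+-suc (m * q) r) ⟩
      F (suc (m * q + r))                            ≡⟨ F-suc (m * q + r) ⟩
      F (m * q + r) + spread m g (suc (m * q + r))   ≡⟨ cong₂ _+_ (flat q (<-trans (n<1+n r) 1+r<m)) (spread-between g q 1+r<m) ⟩
      F (m * q) + 0                                  ≡⟨ +-identityʳ _ ⟩
      F (m * q)                                      ∎
      where open ≡-Reasoning

    jump : ∀ q → F (m * suc q) ≡ F (m * q) + g (suc q)
    jump q = begin
      F (m * suc q)                                          ≡⟨ cong F (m*[1+q]≡1+[m*q+pred[m]] q) ⟩
      F (suc (m * q + pred m))                               ≡⟨ F-suc (m * q + pred m) ⟩
      F (m * q + pred m) + spread m g (suc (m * q + pred m)) ≡⟨ cong₂ _+_ (flat q pred-m<m) (cong (spread m g) (sym (m*[1+q]≡1+[m*q+pred[m]] q))) ⟩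
      F (m * q) + spread m g (m * suc q)                     ≡⟨ cong (F (m * q) +_) (spread-multiple g (suc q)) ⟩
      F (m * q) + g (suc q)                                  ∎
      where
      open ≡-Reasoning
      pred-m<m : pred m < m
      pred-m<m = subst (pred m <_) (suc-pred m) (n<1+n (pred m))

arithmetic-run : (G : ℕ → ℕ) (P d K : ℕ) → (∀ i → i < K → G (P + suc i) ≡ G (P + i) + d) →
                 ∀ i → i ≤ K → G (P + i) ≡ G P + i * d
arithmetic-run G P d K step zero    _     = trans (cong G (+-identityʳ P)) (sym (+-identityʳ (G P)))
arithmetic-run G P d K step (suc i) 1+i≤K = begin
  G (P + suc i)        ≡⟨ step i 1+i≤K ⟩
  G (P + i) + d        ≡⟨ cong (_+ d) (arithmetic-run G P d K step i (<⇒≤ 1+i≤K)) ⟩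
  G P + i * d + d      ≡⟨ +-assoc (G P) (i * d) d ⟩
  G P + (i * d + d)    ≡⟨ cong (G P +_) (+-comm (i * d) d) ⟩
  G P + suc i * d      ∎
  where open ≡-Reasoning

remainder⇒quotient : ∀ {h} .{{_ : NonZero h}} {a r} → a % h ≡ r → ∃[ q ] (a ≡ q * h + r)
remainder⇒quotient {h} {a} {r} a%h≡r = a / h , (begin
  a                  ≡⟨ m≡m%n+[m/n]*n a h ⟩
  a % h + a / h * h  ≡⟨ cong (_+ a / h * h) a%h≡r ⟩
  r + a / h * h      ≡⟨ +-comm r _ ⟩
  a / h * h + r      ∎)
  where open ≡-Reasoning

pred-squared : ∀ h .{{_ : NonZero h}} → (pred h * pred h) % h ≡ 1 % h
pred-squared (suc zero)    = refl
pred-squared (suc (suc k)) = trans (cong (_% suc (suc k)) (square k)) ([m+kn]%n≡m%n 1 k (suc (suc k)))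
  where
  square : ∀ k → suc k * suc k ≡ 1 + k * suc (suc k)
  square = solve-∀

odd⇒[h%2≡1] : ∀ {h} → ¬ 2 ∣ h → h % 2 ≡ 1
odd⇒[h%2≡1] {h} odd with h % 2 in h%2 | m%n<n h 2
... | zero        | _                 = ⊥-elim (odd (m%n≡0⇒n∣m h 2 h%2))
... | suc zero    | _                 = refl
... | suc (suc _) | s≤s (s≤s ())

module Modulo (h : ℕ) .{{_ : NonZero h}} where

  infix 4 _≈_
  _≈_ : ℕ → ℕ → Set
  x ≈ y = x % h ≡ y % h

  mod-≈ : ∀ x → x % h ≈ x
  mod-≈ x = m%n%n≡m%n x h

  +-resp-≈ : ∀ {a a' b b'} → a ≈ a' → b ≈ b' → a + b ≈ a' + b'
  +-resp-≈ {a} {a'} {b} {b'} a≈a' b≈b' = begin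
    (a + b) % h              ≡⟨ %-distribˡ-+ a b h ⟩
    (a % h + b % h) % h      ≡⟨ cong₂ (λ x y → (x + y) % h) a≈a' b≈b' ⟩
    (a' % h + b' % h) % h    ≡⟨ %-distribˡ-+ a' b' h ⟨
    (a' + b') % h            ∎
    where open ≡-Reasoning

  *-resp-≈ : ∀ {a a' b b'} → a ≈ a' → b ≈ b' → a * b ≈ a' * b'
  *-resp-≈ {a} {a'} {b} {b'} a≈a' b≈b' = begin
    (a * b) % h              ≡⟨ %-distribˡ-* a b h ⟩
    (a % h * (b % h)) % h    ≡⟨ cong₂ (λ x y → (x * y) % h) a≈a' b≈b' ⟩
    (a' % h * (b' % h)) % h  ≡⟨ %-distribˡ-* a' b' h ⟨
    (a' * b') % h            ∎
    where open ≡-Reasoning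

  Invertible : ℕ → Set
  Invertible a = ∃[ u ] (a * u ≈ 1)

  invertible-* : ∀ {a b} → Invertible a → Invertible b → Invertible (a * b)
  invertible-* {a} {b} (u , au≈1) (w , bw≈1) =
    u * w , trans (cong (_% h) (regroup a b u w)) (*-resp-≈ au≈1 bw≈1)
    where
    regroup : ∀ a b u w → a * b * (u * w) ≡ a * u * (b * w)
    regroup = solve-∀

  invertible-resp-≈ : ∀ {a b} → a ≈ b → Invertible a → Invertible b
  invertible-resp-≈ a≈b (u , au≈1) = u , trans (*-resp-≈ (sym a≈b) refl) au≈1

  pred-invertible : Invertible (pred h)
  pred-invertible = pred h , pred-squared h

  two-invertible : ¬ 2 ∣ h → Invertible 2
  two-invertible odd = suc (h / 2) , trans (cong (_% h) 2[1+h/2]≡1+h) ([m+kn]%n≡m%n 1 1 h)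
    where
    h≡1+[h/2]*2 : h ≡ 1 + h / 2 * 2
    h≡1+[h/2]*2 = trans (m≡m%n+[m/n]*n h 2) (cong (_+ h / 2 * 2) (odd⇒[h%2≡1] odd))
    double : ∀ q → 2 * suc q ≡ 1 + 1 * (1 + q * 2)
    double = solve-∀
    2[1+h/2]≡1+h : 2 * suc (h / 2) ≡ 1 + 1 * h
    2[1+h/2]≡1+h = trans (double (h / 2)) (cong (λ z → 1 + 1 * z) (sym h≡1+[h/2]*2))

  -- i is (r - Q) / d, computed as (r + (h - 1) Q) v with v the inverse of d.
  progression-hits : ∀ Q {d} → Invertible d → ∀ {r} → r < h → ∃[ i ] (i < h × (Q + i * d) % h ≡ r)
  progression-hits Q {d} (v , dv≈1) {r} r<h = i , m%n<n (t * v) h , (begin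
    (Q + i * d) % h        ≡⟨ +-resp-≈ {Q} refl (*-resp-≈ {i} {t * v} {d} (mod-≈ (t * v)) refl) ⟩
    (Q + t * v * d) % h    ≡⟨ cong (λ z → (Q + z) % h) (reassoc t v d) ⟩
    (Q + t * (d * v)) % h  ≡⟨ +-resp-≈ {Q} refl (*-resp-≈ {t} refl dv≈1) ⟩
    (Q + t * 1) % h        ≡⟨ cong (_% h) (trans (collect Q r (pred h)) (cong (λ z → r + Q * z) (suc-pred h))) ⟩
    (r + Q * h) % h        ≡⟨ [m+kn]%n≡m%n r Q h ⟩
    r % h                  ≡⟨ m<n⇒m%n≡m r<h ⟩
    r                      ∎)
    where
    open ≡-Reasoning
    t = r + pred h * Q
    i = (t * v) % h
    reassoc : ∀ t v d → t * v * d ≡ t * (d * v)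
    reassoc = solve-∀
    collect : ∀ Q r p → Q + (r + p * Q) * 1 ≡ r + Q * suc p
    collect = solve-∀

  module _ (G P : ℕ → ℕ) {s K : ℕ} (s-invertible : Invertible s) (h≤1+K : h ≤ suc K)
           (P-grows : ∀ M → 2 ≤ M → M < P M)
           (runs : ∀ M → 2 ≤ M → ∀ i → i < K → G (P M + suc i) ≡ G (P M + i) + s * G M)
           where

    hits-beyond : ∀ {M} → 2 ≤ M → Invertible (G M) → ∀ {r} → r < h → ∃[ n ] (M < n × G n % h ≡ r)
    hits-beyond {M} 2≤M GM-invertible r<h
      with progression-hits (G (P M)) (invertible-* {s} {G M} s-invertible GM-invertible) r<h
    ... | i , i<h , hit = P M + i , <-≤-trans (P-grows M 2≤M) (m≤m+n (P M) i) ,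
      trans (cong (_% h) (arithmetic-run G (P M) (s * G M) K (runs M 2≤M) i (≤-pred (≤-trans i<h h≤1+K)))) hit

    -- Hitting the residue of 1 yields a later index with invertible value.
    invertible-beyond : ∀ {M₀} → 2 ≤ M₀ → Invertible (G M₀) → ∀ N → ∃[ M ] (N ≤ M × 2 ≤ M × Invertible (G M))
    invertible-beyond 2≤M₀ G-invertible zero = _ , z≤n , 2≤M₀ , G-invertible
    invertible-beyond 2≤M₀ G-invertible (suc N) with invertible-beyond 2≤M₀ G-invertible N
    ... | M , N≤M , 2≤M , GM-invertible with hits-beyond 2≤M GM-invertible (m%n<n 1 h)
    ... | n , M<n , Gn≈1 = n , ≤-<-trans N≤M M<n , ≤-trans 2≤M (<⇒≤ M<n) ,
                           1 , trans (cong (_% h) (*-identityʳ (G n))) Gn≈1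

    every-residue : ∀ {M₀} → 2 ≤ M₀ → Invertible (G M₀) → EveryResidueInfinitelyOften h G
    every-residue 2≤M₀ G-invertible r r<h N with invertible-beyond 2≤M₀ G-invertible N
    ... | M , N≤M , 2≤M , GM-invertible with hits-beyond 2≤M GM-invertible r<h
    ... | n , M<n , Gn%h≡r = n , ≤-trans N≤M (<⇒≤ M<n) , remainder⇒quotient Gn%h≡r

residues-of-subsequence : ∀ {h} (f e : ℕ → ℕ) → (∀ n → n ≤ e n) →
                          EveryResidueInfinitelyOften h (f ∘ e) → EveryResidueInfinitelyOften h f
residues-of-subsequence f e n≤e[n] residues r r<h N with residues r r<h N
... | n , N≤n , hit = e n , ≤-trans N≤n (n≤e[n] n) , hit

n<m*n : ∀ {m n} → 1 < m → 1 ≤ n → n < m * n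
n<m*n {m} {n@(suc _)} 1<m _ = subst (n <_) (*-comm n m) (m<m*n n m 1<m)

module _ (m : ℕ) .{{_ : NonZero m}} (1<m : 1 < m) where

  open Staircase m (b m) (b m) (b-suc m 1<m)

  b-small : ∀ {j} → j < m → b m j ≡ 1
  b-small {j} j<m = begin
    b m j            ≡⟨ cong (λ z → b m (z + j)) (*-zeroʳ m) ⟨
    b m (m * 0 + j)  ≡⟨ flat 0 j<m ⟩
    b m (m * 0)      ≡⟨ cong (b m) (*-zeroʳ m) ⟩
    b m 0            ≡⟨ b-zero m 1<m ⟩
    1                ∎
    where open ≡-Reasoning

  b-residues : ∀ {h} → 3 < h → h ≤ m + 1 → EveryResidueInfinitelyOften h (b m)
  b-residues {h@(suc (suc (suc (suc t))))} (s≤s (s≤s (s≤s (s≤s _)))) h≤m+1 =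
    residues-of-subsequence (b m) (m *_) (λ n → m≤n*m n m)
      (every-residue G P {1} (1 , refl) h≤1+m P-grows runs (s≤s (s≤s z≤n))
        (subst Invertible (sym (G-small (suc (suc t)) (≤-pred h≤1+m))) pred-invertible))
    where
    open Modulo h
    G P : ℕ → ℕ
    G N = b m (m * N)
    P M = pred (m * M)
    h≤1+m : h ≤ suc m
    h≤1+m = subst (h ≤_) (+-comm m 1) h≤m+1
    G-small : ∀ j → j < m → G j ≡ suc j
    G-small zero    _     = trans (cong (b m) (*-zeroʳ m)) (b-zero m 1<m)
    G-small (suc j) 1+j<m = begin
      G (suc j)          ≡⟨ jump j ⟩
      G j + b m (suc j)  ≡⟨ cong₂ _+_ (G-small j (<-trans (n<1+n j) 1+j<m)) (b-small 1+j<m) ⟩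
      suc j + 1          ≡⟨ +-comm (suc j) 1 ⟩
      suc (suc j)        ∎
      where open ≡-Reasoning
    P-grows : ∀ M → 2 ≤ M → M < P M
    P-grows M 2≤M = ∸-monoˡ-≤ 1 (≤-trans (+-monoˡ-≤ M 2≤M) M+M≤m*M)
      where
      M+M≤m*M : M + M ≤ m * M
      M+M≤m*M = subst (_≤ m * M) (cong (M +_) (+-identityʳ M)) (*-monoˡ-≤ M 1<m)
    runs : ∀ M → 2 ≤ M → ∀ i → i < m → G (P M + suc i) ≡ G (P M + i) + 1 * G M
    runs M@(suc _) _ i i<m = begin
      G (P M + suc i)                     ≡⟨ cong G (+-suc (P M) i) ⟩
      G (suc (P M + i))                   ≡⟨ jump (P M + i) ⟩
      G (P M + i) + b m (suc (P M) + i)   ≡⟨ cong (λ z → G (P M + i) + b m (z + i)) (suc-pred (m * M) {{m*n≢0 m M}}) ⟩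
      G (P M + i) + b m (m * M + i)       ≡⟨ cong (G (P M + i) +_) (trans (flat M i<m) (sym (+-identityʳ (G M)))) ⟩
      G (P M + i) + 1 * G M               ∎
      where open ≡-Reasoning

module _ (m : ℕ) .{{_ : NonZero m}} (1<m : 1 < m) where

  private
    F : ℕ → ℕ
    F n = c m (suc n)

  open Staircase m F (c m) (c-suc m 1<m)

  c-residues : ∀ {h} → 3 < h → h ≤ m + 1 → EveryResidueInfinitelyOften h (c m)
  c-residues {h@(suc (suc (suc (suc t))))} (s≤s (s≤s (s≤s (s≤s _)))) h≤m+1 =
    residues-of-subsequence (c m) (λ N → suc (m * N)) (λ n → ≤-trans (m≤n*m n m) (n≤1+n _))
      (every-residue G (m *_) {1} (1 , refl) h≤1+m (λ M 2≤M → n<m*n 1<m (<⇒≤ 2≤M)) runs (s≤s (s≤s z≤n))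
        (subst Invertible (sym (G-small (suc (suc t)) (≤-pred (≤-trans (n≤1+n _) h≤1+m)))) pred-invertible))
    where
    open Modulo h
    G : ℕ → ℕ
    G N = F (m * N)
    h≤1+m : h ≤ suc m
    h≤1+m = subst (h ≤_) (+-comm m 1) h≤m+1
    G-zero : G 0 ≡ 1
    G-zero = trans (cong (c m ∘ suc) (*-zeroʳ m)) (c-one m 1<m)
    G-small : ∀ j → j ≤ m → G j ≡ suc j
    G-small zero    _      = G-zero
    G-small (suc j) 1+j≤m = begin
      G (suc j)        ≡⟨ jump j ⟩
      G j + F j        ≡⟨ cong₂ _+_ (G-small j (<⇒≤ 1+j≤m)) F-small ⟩
      suc j + 1        ≡⟨ +-comm (suc j) 1 ⟩
      suc (suc j)      ∎
      where
      open ≡-Reasoning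
      F-small : F j ≡ 1
      F-small = begin
        F j            ≡⟨ cong (λ z → F (z + j)) (*-zeroʳ m) ⟨
        F (m * 0 + j)  ≡⟨ flat 0 1+j≤m ⟩
        G 0            ≡⟨ G-zero ⟩
        1              ∎
    runs : ∀ M → 2 ≤ M → ∀ i → i < m → G (m * M + suc i) ≡ G (m * M + i) + 1 * G M
    runs M _ i i<m = begin
      G (m * M + suc i)          ≡⟨ cong G (+-suc (m * M) i) ⟩
      G (suc (m * M + i))        ≡⟨ jump (m * M + i) ⟩
      G (m * M + i) + F (m * M + i)  ≡⟨ cong (G (m * M + i) +_) (trans (flat M i<m) (sym (+-identityʳ (G M)))) ⟩
      G (m * M + i) + 1 * G M    ∎
      where open ≡-Reasoning

module _ (m : ℕ) .{{_ : NonZero m}} (1<m : 1 < m) (f : ℕ → ℕ) (f-bbar : IsBbar m f) where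

  private
    f-zero = proj₁ f-bbar
    f-flat = proj₁ (proj₂ f-bbar)
    f-mult = proj₂ (proj₂ f-bbar)

    G : ℕ → ℕ
    G N = f (m * N)

    pred-m<m : pred m < m
    pred-m<m = subst (pred m <_) (suc-pred m) (n<1+n (pred m))

    G-suc : ∀ N → G (suc N) ≡ G N + (f (suc N) + f N)
    G-suc N = begin
      f (m * suc N)                               ≡⟨ f-mult (suc N) (s≤s z≤n) ⟩
      f (m * suc N ∸ 1) + (f (suc N) + f N)       ≡⟨ cong (λ z → f (z ∸ 1) + (f (suc N) + f N)) (m*[1+q]≡1+[m*q+pred[m]] m N) ⟩
      f (m * N + pred m) + (f (suc N) + f N)      ≡⟨ cong (_+ (f (suc N) + f N)) (f-flat N (pred m) pred-m<m) ⟩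
      G N + (f (suc N) + f N)                     ∎
      where open ≡-Reasoning

    f-small : ∀ {j} → j < m → f j ≡ 1
    f-small {j} j<m = begin
      f j            ≡⟨ cong (λ z → f (z + j)) (*-zeroʳ m) ⟨
      f (m * 0 + j)  ≡⟨ f-flat 0 j j<m ⟩
      f (m * 0)      ≡⟨ cong f (*-zeroʳ m) ⟩
      f 0            ≡⟨ f-zero ⟩
      1              ∎
      where open ≡-Reasoning

    G-small : ∀ j → j < m → G j ≡ 1 + 2 * j
    G-small zero    _     = trans (cong f (*-zeroʳ m)) f-zero
    G-small (suc j) 1+j<m = begin
      G (suc j)                   ≡⟨ G-suc j ⟩
      G j + (f (suc j) + f j)     ≡⟨ cong₂ _+_ (G-small j j<m) (cong₂ _+_ (f-small 1+j<m) (f-small j<m)) ⟩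
      1 + 2 * j + (1 + 1)         ≡⟨ two-more j ⟩
      1 + 2 * suc j               ∎
      where
      open ≡-Reasoning
      j<m = <-trans (n<1+n j) 1+j<m
      two-more : ∀ j → 1 + 2 * j + (1 + 1) ≡ 1 + 2 * suc j
      two-more = solve-∀

    runs : ∀ M → 2 ≤ M → ∀ i → i < pred m → G (m * M + suc i) ≡ G (m * M + i) + 2 * G M
    runs M _ i i<pred-m = begin
      G (m * M + suc i)                                   ≡⟨ cong G (+-suc (m * M) i) ⟩
      G (suc (m * M + i))                                 ≡⟨ G-suc (m * M + i) ⟩
      G (m * M + i) + (f (suc (m * M + i)) + f (m * M + i)) ≡⟨ cong (G (m * M + i) +_) (cong₂ _+_ (trans (cong f (sym (+-suc (m * M) i))) (f-flat M (suc i) 1+i<m)) (f-flat M i (<-trans (n<1+n i) 1+i<m))) ⟩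
      G (m * M + i) + (G M + G M)                         ≡⟨ cong (λ z → G (m * M + i) + (G M + z)) (+-identityʳ (G M)) ⟨
      G (m * M + i) + 2 * G M                             ∎
      where
      open ≡-Reasoning
      1+i<m : suc i < m
      1+i<m = subst (suc i <_) (suc-pred m) (s≤s i<pred-m)

  bbar-residues : ∀ {h} → 2 < h → h ≤ m → ¬ 2 ∣ h → EveryResidueInfinitelyOften h f
  bbar-residues {h@(suc (suc (suc t)))} (s≤s (s≤s (s≤s _))) h≤m odd =
    residues-of-subsequence f (m *_) (λ n → m≤n*m n m)
      (every-residue G (m *_) {2} {pred m} (two-invertible odd) (subst (h ≤_) (sym (suc-pred m)) h≤m)
        (λ M 2≤M → n<m*n 1<m (<⇒≤ 2≤M)) runs (s≤s (s≤s z≤n))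
        (invertible-resp-≈ {pred h} {G (pred h)} pred-h≈G[pred-h] pred-invertible))
    where
    open Modulo h
    pred-h≈G[pred-h] : pred h ≈ G (pred h)
    pred-h≈G[pred-h] = begin
      (2 + t) % h                       ≡⟨ [m+kn]%n≡m%n (2 + t) 1 h ⟨
      ((2 + t) + 1 * h) % h             ≡⟨ cong (_% h) (fold t) ⟩
      (1 + 2 * (2 + t)) % h             ≡⟨ cong (_% h) (G-small (2 + t) h≤m) ⟨
      G (2 + t) % h                     ∎
      where
      open ≡-Reasoning
      fold : ∀ t → (2 + t) + 1 * (3 + t) ≡ 1 + 2 * (2 + t)
      fold = solve-∀

corollary2 : (m h : ℕ) → 2 ≤ m → 3 < h →
    ((h ≤ m + 1) →
      EveryResidueInfinitelyOften h (b m) × EveryResidueInfinitelyOften h (c m))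
  × ((h ≤ m) → ¬ (2 ∣ h) → (f : ℕ → ℕ) → IsBbar m f →
      EveryResidueInfinitelyOften h f)
corollary2 m h 2≤m@(s≤s (s≤s _)) 3<h =
    (λ h≤m+1 → b-residues m 2≤m 3<h h≤m+1 , c-residues m 2≤m 3<h h≤m+1)
  , (λ h≤m odd f f-bbar → bbar-residues m 2≤m f f-bbar (<⇒≤ 3<h) h≤m odd)
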